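{- Let $k$ be a field and $a,b,K\in k$ with $a\neq 0$, and suppose the projective closure $C\subset\mathbb{P}^2$ of the affine curve $$xy(x+y)+a(x+y)^2+(a^2+b)(x+y)+ab=Kxy$$ is smooth. Equip $C$ with the group law described in the context (identity $\mathcal{O}=[1:-1:0]$), and let $\mathcal{P}=[1:0:0]$. Then for every affine point $(x,y)\in C$ with $x\neq 0$, $$(x,y)+\mathcal{P}=\varphi(x,y):=\left(y,\ \frac{ay+b}{x}\right),$$ i.e. on $C$ the Lyness map $\varphi$ acts as translation by $\mathcal{P}$.
   Context: The projective closure of the curve is $xy(x+y)+a(x+y)^2z+(a^2+b)(x+y)z^2+abz^3-Kxyz=0$; its points at infinity are $\mathcal{O}=[1:-1:0]$ (written $(\infty,\infty)$), $\mathcal{P}=[1:0:0]$ (written $(\infty,-a)$) and $[0:1:0]$ (written $(-a,\infty)$). The group law on $C$ is the chord-and-tangent law with identity $\mathcal{O}$: for $Q_1,Q_2\in C$, let $R$ be the third intersection of the line through $Q_1,Q_2$ (the tangent line if $Q_1=Q_2$) with $C$, and define $Q_1+Q_2$ to be the third intersection with $C$ of the line through $\mathcal{O}$ and $R$ (tangent at $\mathcal O$ if $R=\mathcal O$). -}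

module Defs where

open import Level using (Level; _⊔_) renaming (suc to lsuc)
open import Algebra.Bundles using (CommutativeRing)
open import Algebra.Morphism.Structures using (module RingMorphisms)
open import Data.Product using (Σ; ∃; _×_; _,_)
open import Relation.Nullary using (¬_)

record Field c ℓ : Set (lsuc (c ⊔ ℓ)) where
  field
    commutativeRing : CommutativeRing c ℓ
  open CommutativeRing commutativeRing public
  field
    1≉0     : ¬ (1# ≈ 0#)
    inverse : ∀ x → ¬ (x ≈ 0#) → ∃ λ y → x * y ≈ 1#

record Triple {c} (A : Set c) : Set c where
  constructor ⟨_,_,_⟩
  field
    X Y Z : A

-- A linear form  p·s + q·t  in the variables s, t.
record Lin {c} (A : Set c) : Set c where
  constructor lin
  field
    p q : A

-- A binary cubic form  c30·s³ + c21·s²t + c12·st² + c03·t³ (coefficient list).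
record Cub {c} (A : Set c) : Set c where
  constructor cub
  field
    c30 c21 c12 c03 : A

module Curve {c ℓ} (R : CommutativeRing c ℓ) (a b K : CommutativeRing.Carrier R) where
  open CommutativeRing R
  open Triple
  open Lin
  open Cub

  F : Triple Carrier → Carrier
  F ⟨ x , y , z ⟩ =
    x * y * (x + y) + a * ((x + y) * (x + y)) * z + (a * a + b) * (x + y) * (z * z)
    + a * b * (z * z * z) - K * x * y * z

  Fx : Triple Carrier → Carrier
  Fx ⟨ x , y , z ⟩ =
    (x * y + x * y) + y * y + (a * (x + y) * z + a * (x + y) * z) + (a * a + b) * (z * z)
    - K * y * z

  Fy : Triple Carrier → Carrier
  Fy ⟨ x , y , z ⟩ =
    x * x + (x * y + x * y) + (a * (x + y) * z + a * (x + y) * z) + (a * a + b) * (z * z)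
    - K * x * z

  Fz : Triple Carrier → Carrier
  Fz ⟨ x , y , z ⟩ =
    a * ((x + y) * (x + y)) + ((a * a + b) * (x + y) * z + (a * a + b) * (x + y) * z)
    + (a * b * (z * z) + a * b * (z * z) + a * b * (z * z)) - K * x * y

  _≈₃_ : Triple Carrier → Triple Carrier → Set ℓ
  P ≈₃ Q = (X P ≈ X Q) × (Y P ≈ Y Q) × (Z P ≈ Z Q)

  _·₃_ : Carrier → Triple Carrier → Triple Carrier
  l ·₃ P = ⟨ l * X P , l * Y P , l * Z P ⟩

  _+₃_ : Triple Carrier → Triple Carrier → Triple Carrier
  P +₃ Q = ⟨ X P + X Q , Y P + Y Q , Z P + Z Q ⟩

  IsZero₃ : Triple Carrier → Set ℓ
  IsZero₃ P = (X P ≈ 0#) × (Y P ≈ 0#) × (Z P ≈ 0#)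

  -- cross product (U, V span a line iff U × V ≠ 0)
  cross : Triple Carrier → Triple Carrier → Triple Carrier
  cross U V = ⟨ Y U * Z V - Z U * Y V , Z U * X V - X U * Z V , X U * Y V - Y U * X V ⟩

  _∼_ : Triple Carrier → Triple Carrier → Set (c ⊔ ℓ)
  P ∼ Q = ∃ λ l → ¬ (l ≈ 0#) × (P ≈₃ (l ·₃ Q))

  IsPoint : Triple Carrier → Set ℓ
  IsPoint P = ¬ IsZero₃ P

  OnC : Triple Carrier → Set ℓ
  OnC P = F P ≈ 0#

  Singular : Triple Carrier → Set ℓ
  Singular P = IsPoint P × (F P ≈ 0#) × (Fx P ≈ 0#) × (Fy P ≈ 0#) × (Fz P ≈ 0#)

  _≈C_ : Cub Carrier → Cub Carrier → Set ℓ
  f ≈C g = (c30 f ≈ c30 g) × (c21 f ≈ c21 g) × (c12 f ≈ c12 g) × (c03 f ≈ c03 g)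

  _+C_ : Cub Carrier → Cub Carrier → Cub Carrier
  f +C g = cub (c30 f + c30 g) (c21 f + c21 g) (c12 f + c12 g) (c03 f + c03 g)

  _·C_ : Carrier → Cub Carrier → Cub Carrier
  l ·C f = cub (l * c30 f) (l * c21 f) (l * c12 f) (l * c03 f)

  _+L_ : Lin Carrier → Lin Carrier → Lin Carrier
  u +L v = lin (p u + p v) (q u + q v)

  mul3 : Lin Carrier → Lin Carrier → Lin Carrier → Cub Carrier
  mul3 (lin p1 q1) (lin p2 q2) (lin p3 q3) =
    cub (p1 * p2 * p3)
        (p1 * p2 * q3 + (p1 * q2 + q1 * p2) * p3)
        ((p1 * q2 + q1 * p2) * q3 + q1 * q2 * p3)
        (q1 * q2 * q3)

  -- The binary cubic form  F(s·U + t·V)  (restriction of F to the line UV).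
  FonLine : Triple Carrier → Triple Carrier → Cub Carrier
  FonLine U V =
    mul3 lx ly lxy +C ((a ·C mul3 lxy lxy lz) +C (((a * a + b) ·C mul3 lxy lz lz)
    +C (((a * b) ·C mul3 lz lz lz) +C ((- K) ·C mul3 lx ly lz))))
    where
      lx = lin (X U) (X V)
      ly = lin (Y U) (Y V)
      lz = lin (Z U) (Z V)
      lxy = lx +L ly

  -- The linear form in s, t vanishing at the parameter (s₀ : t₀): t₀·s − s₀·t
  rootForm : Carrier → Carrier → Lin Carrier
  rootForm s₀ t₀ = lin t₀ (- s₀)

  -- Line · C = A + B + R as divisors: there is a line, spanned by U, V,
  -- containing A, B, R with parameters (sA:tA), (sB:tB), (sR:tR), such that
  -- F restricted to the line equals (as a polynomial) c·∏ of the corresponding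
  -- linear factors with c ≠ 0.  (For A = B this forces the line to be the
  -- tangent line at A.)
  LineMeets : Triple Carrier → Triple Carrier → Triple Carrier → Set (c ⊔ ℓ)
  LineMeets A B R =
    Σ (Triple Carrier) λ U → Σ (Triple Carrier) λ V →
    Σ Carrier λ sA → Σ Carrier λ tA → Σ Carrier λ sB → Σ Carrier λ tB →
    Σ Carrier λ sR → Σ Carrier λ tR → Σ Carrier λ κ →
      ¬ IsZero₃ (cross U V)
    × (A ∼ ((sA ·₃ U) +₃ (tA ·₃ V)))
    × (B ∼ ((sB ·₃ U) +₃ (tB ·₃ V)))
    × (R ∼ ((sR ·₃ U) +₃ (tR ·₃ V)))
    × ¬ (κ ≈ 0#)
    × (FonLine U V ≈C (κ ·C mul3 (rootForm sA tA) (rootForm sB tB) (rootForm sR tR)))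

  𝒪 : Triple Carrier
  𝒪 = ⟨ 1# , - 1# , 0# ⟩

  𝒫 : Triple Carrier
  𝒫 = ⟨ 1# , 0# , 0# ⟩

  -- Chord-and-tangent law with identity 𝒪:  Q₁ + Q₂ = S  iff, with R the
  -- third intersection of the line Q₁Q₂ with C, S is the third intersection
  -- of the line 𝒪R with C.
  IsSum : Triple Carrier → Triple Carrier → Triple Carrier → Set (c ⊔ ℓ)
  IsSum Q₁ Q₂ S = Σ (Triple Carrier) λ R → LineMeets Q₁ Q₂ R × LineMeets 𝒪 R S

-- Smoothness of C: no singular point over any field extension of k
-- (in particular over an algebraic closure).
Smooth : ∀ {c ℓ} (k : Field c ℓ) (a b K : Field.Carrier k) → Set (lsuc (c ⊔ ℓ))
Smooth {c} {ℓ} k a b K =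
  (L : Field c ℓ) (ι : Field.Carrier k → Field.Carrier L) →
  RingMorphisms.IsRingHomomorphism (Field.rawRing k) (Field.rawRing L) ι →
  (P : Triple (Field.Carrier L)) →
  ¬ Curve.Singular (Field.commutativeRing L) (ι a) (ι b) (ι K) P

module Submission where

-- The horizontal line through Q and 𝒫 meets C again at
-- R = (x′, y) with x′ = (ay + b)/x, by Vieta applied to F(X, y, 1); the line
-- x + y = x′ + y through 𝒪 and R meets C again at the mirror image (y, x′)
-- of R.  The chords are degenerate only when y = −a or x′ + y = K, and on
-- these lines the cubic reduces to x·(aK + b), resp. to (K + a)(aK + b).
-- Smoothness forces aK + b ≠ 0 and K + a ≠ 0: otherwise C has an explicit
-- singular point, for K = −a defined over k or over the quadratic extension
-- k[θ]/(θ² + aθ + a² − b), which is constructed here as a field.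

open import Defs
open import Level using (0ℓ; _⊔_)
open import Algebra.Bundles using (CommutativeRing)
open import Algebra.Morphism.Structures using (module RingMorphisms)
open import Algebra.Morphism.Construct.Identity using (isRingHomomorphism)
open import Algebra.Solver.Ring.AlmostCommutativeRing
  using (fromCommutativeRing; _-Raw-AlmostCommutative⟶_)
open import Data.Nat.Base as ℕ using (ℕ; zero; suc)
import Data.Nat.Properties as ℕ
open import Data.Integer.Base as ℤ using (ℤ; +_; -[1+_])
import Data.Integer.Properties as ℤ
import Data.Sign.Base as Sign
open import Data.Maybe.Base using (Maybe; just; nothing)
open import Data.Product using (_×_; _,_; Σ; proj₁; proj₂)
open import Relation.Nullary using (¬_; yes; no)
open import Relation.Nullary.Decidable using (¬¬-excluded-middle)
import Relation.Binary.PropositionalEquality.Core as ≡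

-- Every commutative ring R receives a ring homomorphism from ℤ.  This makes
-- ℤ a coefficient ring for the library's ring solver over R, so that
-- polynomial identities with integer coefficients can be checked by
-- normalisation.
module IntegerSolver {c ℓ} (R : CommutativeRing c ℓ) where
  open CommutativeRing R
  open import Algebra.Properties.Semiring.Mult.TCOptimised semiring
    using (1+×; ×-homo-+; ×1-homo-*) renaming (_×_ to _×ₙ_)
  open import Algebra.Properties.Ring ring using (-‿distribˡ-*; -‿distribʳ-*; -0#≈0#)
  open import Algebra.Properties.AbelianGroup +-abelianGroup using (⁻¹-∙-comm; ⁻¹-involutive)
  open import Relation.Binary.Reasoning.Setoid setoid

  nat : ℕ → Carrier
  nat n = n ×ₙ 1#

  int : ℤ → Carrier
  int (+ n)    = nat n
  int -[1+ n ] = - nat (suc n)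

  private
    cancel-1# : ∀ p q → (1# + p) - (1# + q) ≈ p - q
    cancel-1# p q = begin
      (1# + p) + - (1# + q)    ≈⟨ +-congˡ (sym (⁻¹-∙-comm 1# q)) ⟩
      (1# + p) + (- 1# + - q)  ≈⟨ +-congʳ (+-comm 1# p) ⟩
      (p + 1#) + (- 1# + - q)  ≈⟨ +-assoc p 1# _ ⟩
      p + (1# + (- 1# + - q))  ≈⟨ +-congˡ (sym (+-assoc 1# (- 1#) (- q))) ⟩
      p + ((1# - 1#) + - q)    ≈⟨ +-congˡ (+-congʳ (-‿inverseʳ 1#)) ⟩
      p + (0# + - q)           ≈⟨ +-congˡ (+-identityˡ (- q)) ⟩
      p - q                    ∎

  int-⊖ : ∀ m n → int (m ℤ.⊖ n) ≈ nat m - nat n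
  int-⊖ m       zero    = sym (trans (+-congˡ -0#≈0#) (+-identityʳ (nat m)))
  int-⊖ zero    (suc n) = sym (+-identityˡ _)
  int-⊖ (suc m) (suc n) = begin
    int (suc m ℤ.⊖ suc n)   ≡⟨ ≡.cong int (ℤ.[1+m]⊖[1+n]≡m⊖n m n) ⟩
    int (m ℤ.⊖ n)           ≈⟨ int-⊖ m n ⟩
    nat m - nat n           ≈⟨ cancel-1# (nat m) (nat n) ⟨
    (1# + nat m) - (1# + nat n)
                            ≈⟨ +-cong (1+× m 1#) (-‿cong (1+× n 1#)) ⟨
    nat (suc m) - nat (suc n) ∎

  int-neg : ∀ i → int (ℤ.- i) ≈ - int i
  int-neg (+ zero)  = sym -0#≈0#
  int-neg (+ suc n) = refl
  int-neg -[1+ n ]  = sym (⁻¹-involutive _)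

  int-+ : ∀ i j → int (i ℤ.+ j) ≈ int i + int j
  int-+ -[1+ m ] -[1+ n ] = begin
    - nat (suc (suc (m ℕ.+ n)))   ≡⟨ ≡.cong (λ k → - nat (suc k)) (≡.sym (ℕ.+-suc m n)) ⟩
    - nat (suc m ℕ.+ suc n)       ≈⟨ -‿cong (×-homo-+ 1# (suc m) (suc n)) ⟩
    - (nat (suc m) + nat (suc n)) ≈⟨ ⁻¹-∙-comm _ _ ⟨
    - nat (suc m) + - nat (suc n) ∎
  int-+ -[1+ m ] (+ n)    = trans (int-⊖ n (suc m)) (+-comm _ _)
  int-+ (+ m)    -[1+ n ] = int-⊖ m (suc n)
  int-+ (+ m)    (+ n)    = ×-homo-+ 1# m n

  private
    int-+◃ : ∀ n → int (Sign.+ ℤ.◃ n) ≈ nat n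
    int-+◃ n = reflexive (≡.cong int (ℤ.+◃n≡+n n))

    int--◃ : ∀ n → int (Sign.- ℤ.◃ n) ≈ - nat n
    int--◃ n = trans (reflexive (≡.cong int (ℤ.-◃n≡-n n))) (int-neg (+ n))

    neg*neg : ∀ x y → - x * - y ≈ x * y
    neg*neg x y = begin
      - x * - y     ≈⟨ -‿distribˡ-* x (- y) ⟨
      - (x * - y)   ≈⟨ -‿cong (-‿distribʳ-* x y) ⟨
      - - (x * y)   ≈⟨ ⁻¹-involutive _ ⟩
      x * y         ∎

  int-* : ∀ i j → int (i ℤ.* j) ≈ int i * int j
  int-* (+ m) (+ n) = trans (int-+◃ (m ℕ.* n)) (×1-homo-* m n)
  int-* (+ m) -[1+ n ] = begin
    int (Sign.- ℤ.◃ (m ℕ.* suc n)) ≈⟨ int--◃ (m ℕ.* suc n) ⟩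
    - nat (m ℕ.* suc n)            ≈⟨ -‿cong (×1-homo-* m (suc n)) ⟩
    - (nat m * nat (suc n))        ≈⟨ -‿distribʳ-* _ _ ⟩
    nat m * - nat (suc n)          ∎
  int-* -[1+ m ] (+ n) = begin
    int (Sign.- ℤ.◃ (suc m ℕ.* n)) ≈⟨ int--◃ (suc m ℕ.* n) ⟩
    - nat (suc m ℕ.* n)            ≈⟨ -‿cong (×1-homo-* (suc m) n) ⟩
    - (nat (suc m) * nat n)        ≈⟨ -‿distribˡ-* _ _ ⟩
    - nat (suc m) * nat n          ∎
  int-* -[1+ m ] -[1+ n ] = begin
    int (Sign.+ ℤ.◃ (suc m ℕ.* suc n)) ≈⟨ int-+◃ (suc m ℕ.* suc n) ⟩
    nat (suc m ℕ.* suc n)              ≈⟨ ×1-homo-* (suc m) (suc n) ⟩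
    nat (suc m) * nat (suc n)          ≈⟨ neg*neg _ _ ⟨
    - nat (suc m) * - nat (suc n)      ∎

  int-homomorphism : ℤ.+-*-rawRing -Raw-AlmostCommutative⟶ fromCommutativeRing R
  int-homomorphism = record
    { ⟦_⟧    = int
    ; +-homo = int-+
    ; *-homo = int-*
    ; -‿homo = int-neg
    ; 0-homo = refl
    ; 1-homo = refl
    }

  int-≟ : ∀ i j → Maybe (int i ≈ int j)
  int-≟ i j with i ℤ.≟ j
  ... | yes ≡.refl = just refl
  ... | no _       = nothing

  open import Algebra.Solver.Ring ℤ.+-*-rawRing (fromCommutativeRing R) int-homomorphism int-≟
    public

  0ₚ 1ₚ : ∀ {n} → Polynomial n
  0ₚ = con (+ 0)
  1ₚ = con (+ 1)

  -- Polynomial expressions in n variables form a commutative ring when two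
  -- expressions are identified as soon as they agree at every point of Rⁿ;
  -- every law is the corresponding law of R.  Instantiating the curve
  -- definitions of Defs at this ring yields their symbolic form, which the
  -- solver can normalise and which evaluates back to them definitionally.
  _≐_ : ∀ {n} → Polynomial n → Polynomial n → Set (c ⊔ ℓ)
  p ≐ q = ∀ ρ → ⟦ p ⟧ ρ ≈ ⟦ q ⟧ ρ

  polynomialRing : ℕ → CommutativeRing 0ℓ (c ⊔ ℓ)
  polynomialRing n = record
    { Carrier = Polynomial n ; _≈_ = _≐_ ; _+_ = _:+_ ; _*_ = _:*_ ; -_ = :-_
    ; 0# = 0ₚ ; 1# = 1ₚ
    ; isCommutativeRing = record
      { isRing = record
        { +-isAbelianGroup = record
          { isGroup = record
            { isMonoid = record
              { isSemigroup = record
                { isMagma = record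
                  { isEquivalence = record
                    { refl  = λ ρ → refl
                    ; sym   = λ e ρ → sym (e ρ)
                    ; trans = λ e f ρ → trans (e ρ) (f ρ) }
                  ; ∙-cong = λ e f ρ → +-cong (e ρ) (f ρ) }
                ; assoc = λ p q r ρ → +-assoc _ _ _ }
              ; identity = (λ p ρ → +-identityˡ _) , (λ p ρ → +-identityʳ _) }
            ; inverse = (λ p ρ → -‿inverseˡ _) , (λ p ρ → -‿inverseʳ _)
            ; ⁻¹-cong = λ e ρ → -‿cong (e ρ) }
          ; comm = λ p q ρ → +-comm _ _ }
        ; *-cong     = λ e f ρ → *-cong (e ρ) (f ρ)
        ; *-assoc    = λ p q r ρ → *-assoc _ _ _
        ; *-identity = (λ p ρ → *-identityˡ _) , (λ p ρ → *-identityʳ _)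
        ; distrib    = (λ p q r ρ → distribˡ _ _ _) , (λ p q r ρ → distribʳ _ _ _) }
      ; *-comm = λ p q ρ → *-comm _ _ } }

  -- Certificates.  To derive l = r from hypotheses hᵢ = 0, the solver checks
  -- the polynomial identity  l = r + Σ cᵢ·hᵢ  and the lemmas below discard
  -- the vanishing combination  Σ cᵢ·hᵢ.
  drop-vanishing : ∀ {l r e} → l ≈ r + e → e ≈ 0# → l ≈ r
  drop-vanishing {r = r} l≈r+e e≈0 = trans l≈r+e (trans (+-congˡ e≈0) (+-identityʳ r))

  infixl 6 _⊕₀_
  infixr 7 _⊙₀_

  _⊙₀_ : ∀ c {h} → h ≈ 0# → c * h ≈ 0#
  c ⊙₀ h≈0 = trans (*-congˡ h≈0) (zeroʳ c)

  _⊕₀_ : ∀ {u v} → u ≈ 0# → v ≈ 0# → u + v ≈ 0#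
  u≈0 ⊕₀ v≈0 = trans (+-cong u≈0 v≈0) (+-identityʳ 0#)

  as-difference : ∀ {x y} → x ≈ y → x - y ≈ 0#
  as-difference {y = y} x≈y = trans (+-congʳ x≈y) (-‿inverseʳ y)

module Symbolic {c ℓ} (R : CommutativeRing c ℓ) {n : ℕ} (a b K : IntegerSolver.Polynomial R n) =
  Curve (IntegerSolver.polynomialRing R n) a b K

-- Two explicit singular points, valid over any commutative ring.
--  * If aK + b = 0, then (−a, −a) is singular.
--  * If K + a = 0, then C contains the line x + y + a = 0, which meets the
--    residual conic at the points (t, −(a+t)) with t² + at + (a² − b) = 0;
--    these are singular.
module SingularPoints {c ℓ} (R : CommutativeRing c ℓ) (a b K : CommutativeRing.Carrier R)
  (1≉0 : ¬ (CommutativeRing._≈_ R (CommutativeRing.1# R) (CommutativeRing.0# R))) where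
  open CommutativeRing R
  open IntegerSolver R
  open Curve R a b K

  affine-is-point : ∀ u v → IsPoint ⟨ u , v , 1# ⟩
  affine-is-point u v (_ , _ , 1≈0) = 1≉0 1≈0

  singular-diagonal : a * K + b ≈ 0# → Singular ⟨ - a , - a , 1# ⟩
  singular-diagonal h = affine-is-point (- a) (- a) , eF , eFx , eFy , eFz
    where
      eF : F ⟨ - a , - a , 1# ⟩ ≈ 0#
      eF = drop-vanishing (solve 3 (λ a b K → let module S = Symbolic R a b K in
             S.F ⟨ :- a , :- a , 1ₚ ⟩ := 0ₚ :+ (:- a) :* (a :* K :+ b)) refl a b K) ((- a) ⊙₀ h)
      eFx : Fx ⟨ - a , - a , 1# ⟩ ≈ 0#
      eFx = drop-vanishing (solve 3 (λ a b K → let module S = Symbolic R a b K in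
             S.Fx ⟨ :- a , :- a , 1ₚ ⟩ := 0ₚ :+ 1ₚ :* (a :* K :+ b)) refl a b K) (1# ⊙₀ h)
      eFy : Fy ⟨ - a , - a , 1# ⟩ ≈ 0#
      eFy = drop-vanishing (solve 3 (λ a b K → let module S = Symbolic R a b K in
             S.Fy ⟨ :- a , :- a , 1ₚ ⟩ := 0ₚ :+ 1ₚ :* (a :* K :+ b)) refl a b K) (1# ⊙₀ h)
      eFz : Fz ⟨ - a , - a , 1# ⟩ ≈ 0#
      eFz = drop-vanishing (solve 3 (λ a b K → let module S = Symbolic R a b K in
             S.Fz ⟨ :- a , :- a , 1ₚ ⟩ := 0ₚ :+ (:- a) :* (a :* K :+ b)) refl a b K) ((- a) ⊙₀ h)

  singular-on-line : ∀ t → K + a ≈ 0# → t * t + a * t + (a * a - b) ≈ 0# →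
    Singular ⟨ t , - (a + t) , 1# ⟩
  singular-on-line t hK hq = affine-is-point t (- (a + t)) , eF , eFx , eFy , eFz
    where
      eF : F ⟨ t , - (a + t) , 1# ⟩ ≈ 0#
      eF = drop-vanishing (solve 4 (λ a b K t → let module S = Symbolic R a b K in
             S.F ⟨ t , :- (a :+ t) , 1ₚ ⟩
               := 0ₚ :+ t :* (a :+ t) :* (K :+ a))
             refl a b K t) ((t * (a + t)) ⊙₀ hK)
      eFx : Fx ⟨ t , - (a + t) , 1# ⟩ ≈ 0#
      eFx = drop-vanishing (solve 4 (λ a b K t → let module S = Symbolic R a b K in
             S.Fx ⟨ t , :- (a :+ t) , 1ₚ ⟩
               := 0ₚ :+ ((a :+ t) :* (K :+ a) :+ (:- 1ₚ) :* (t :* t :+ a :* t :+ (a :* a :- b))))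
             refl a b K t) ((a + t) ⊙₀ hK ⊕₀ (- 1#) ⊙₀ hq)
      eFy : Fy ⟨ t , - (a + t) , 1# ⟩ ≈ 0#
      eFy = drop-vanishing (solve 4 (λ a b K t → let module S = Symbolic R a b K in
             S.Fy ⟨ t , :- (a :+ t) , 1ₚ ⟩
               := 0ₚ :+ ((:- t) :* (K :+ a) :+ (:- 1ₚ) :* (t :* t :+ a :* t :+ (a :* a :- b))))
             refl a b K t) ((- t) ⊙₀ hK ⊕₀ (- 1#) ⊙₀ hq)
      eFz : Fz ⟨ t , - (a + t) , 1# ⟩ ≈ 0#
      eFz = drop-vanishing (solve 4 (λ a b K t → let module S = Symbolic R a b K in
             S.Fz ⟨ t , :- (a :+ t) , 1ₚ ⟩
               := 0ₚ :+ ((t :* (a :+ t)) :* (K :+ a) :+ (:- a) :* (t :* t :+ a :* t :+ (a :* a :- b))))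
             refl a b K t) ((t * (a + t)) ⊙₀ hK ⊕₀ (- a) ⊙₀ hq)

-- The quadratic algebra R[θ]/(θ² + αθ + β): a pair (u , v) stands for u + vθ,
-- and θ² = −αθ − β determines the product.
module QuadraticAlgebra {c ℓ} (R : CommutativeRing c ℓ) (α β : CommutativeRing.Carrier R) where
  open CommutativeRing R

  _≋_ : Carrier × Carrier → Carrier × Carrier → Set ℓ
  (u , v) ≋ (u′ , v′) = (u ≈ u′) × (v ≈ v′)

  _⊕_ : Carrier × Carrier → Carrier × Carrier → Carrier × Carrier
  (u , v) ⊕ (u′ , v′) = (u + u′ , v + v′)

  _⊗_ : Carrier × Carrier → Carrier × Carrier → Carrier × Carrier
  (u , v) ⊗ (u′ , v′) = (u * u′ - β * (v * v′) , u * v′ + v * u′ - α * (v * v′))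

  ⊖_ : Carrier × Carrier → Carrier × Carrier
  ⊖ (u , v) = (- u , - v)

  -- the norm (u + vθ)(u + vθ̄), where θ̄ = −α − θ is the conjugate root
  norm : Carrier × Carrier → Carrier
  norm (u , v) = u * u - α * u * v + β * (v * v)

  conjugate : Carrier × Carrier → Carrier × Carrier
  conjugate (u , v) = (u - α * v , - v)

  ι : Carrier → Carrier × Carrier
  ι u = (u , 0#)

  θ : Carrier × Carrier
  θ = (0# , 1#)

module SymbolicQuadratic {c ℓ} (R : CommutativeRing c ℓ) {n : ℕ} (α β : IntegerSolver.Polynomial R n) =
  QuadraticAlgebra (IntegerSolver.polynomialRing R n) α β using ()
  renaming (_⊕_ to _⊕ₛ_; _⊗_ to _⊗ₛ_; ι to ιₛ; θ to θₛ; norm to normₛ; conjugate to conjugateₛ)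

module QuadraticRing {c ℓ} (R : CommutativeRing c ℓ) (α β : CommutativeRing.Carrier R) where
  open CommutativeRing R
  open IntegerSolver R
  open QuadraticAlgebra R α β

  ⊗-assoc : ∀ x y z → ((x ⊗ y) ⊗ z) ≋ (x ⊗ (y ⊗ z))
  ⊗-assoc (u , v) (u′ , v′) (u″ , v″) =
    solve 8 (λ α β u v u′ v′ u″ v″ → let open SymbolicQuadratic R α β in
      proj₁ (((u , v) ⊗ₛ (u′ , v′)) ⊗ₛ (u″ , v″)) := proj₁ ((u , v) ⊗ₛ ((u′ , v′) ⊗ₛ (u″ , v″))))
      refl α β u v u′ v′ u″ v″ ,
    solve 8 (λ α β u v u′ v′ u″ v″ → let open SymbolicQuadratic R α β in
      proj₂ (((u , v) ⊗ₛ (u′ , v′)) ⊗ₛ (u″ , v″)) := proj₂ ((u , v) ⊗ₛ ((u′ , v′) ⊗ₛ (u″ , v″))))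
      refl α β u v u′ v′ u″ v″

  ⊗-comm : ∀ x y → (x ⊗ y) ≋ (y ⊗ x)
  ⊗-comm (u , v) (u′ , v′) =
    solve 6 (λ α β u v u′ v′ → let open SymbolicQuadratic R α β in
      proj₁ ((u , v) ⊗ₛ (u′ , v′)) := proj₁ ((u′ , v′) ⊗ₛ (u , v))) refl α β u v u′ v′ ,
    solve 6 (λ α β u v u′ v′ → let open SymbolicQuadratic R α β in
      proj₂ ((u , v) ⊗ₛ (u′ , v′)) := proj₂ ((u′ , v′) ⊗ₛ (u , v))) refl α β u v u′ v′

  ⊗-identityˡ : ∀ x → (ι 1# ⊗ x) ≋ x
  ⊗-identityˡ (u , v) =
    solve 4 (λ α β u v → let open SymbolicQuadratic R α β in proj₁ (ιₛ 1ₚ ⊗ₛ (u , v)) := u) refl α β u v ,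
    solve 4 (λ α β u v → let open SymbolicQuadratic R α β in proj₂ (ιₛ 1ₚ ⊗ₛ (u , v)) := v) refl α β u v

  ⊗-identityʳ : ∀ x → (x ⊗ ι 1#) ≋ x
  ⊗-identityʳ (u , v) =
    solve 4 (λ α β u v → let open SymbolicQuadratic R α β in proj₁ ((u , v) ⊗ₛ ιₛ 1ₚ) := u) refl α β u v ,
    solve 4 (λ α β u v → let open SymbolicQuadratic R α β in proj₂ ((u , v) ⊗ₛ ιₛ 1ₚ) := v) refl α β u v

  ⊗-distribˡ : ∀ x y z → (x ⊗ (y ⊕ z)) ≋ ((x ⊗ y) ⊕ (x ⊗ z))
  ⊗-distribˡ (u , v) (u′ , v′) (u″ , v″) =
    solve 8 (λ α β u v u′ v′ u″ v″ → let open SymbolicQuadratic R α β in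
      proj₁ ((u , v) ⊗ₛ ((u′ , v′) ⊕ₛ (u″ , v″)))
        := proj₁ (((u , v) ⊗ₛ (u′ , v′)) ⊕ₛ ((u , v) ⊗ₛ (u″ , v″))))
      refl α β u v u′ v′ u″ v″ ,
    solve 8 (λ α β u v u′ v′ u″ v″ → let open SymbolicQuadratic R α β in
      proj₂ ((u , v) ⊗ₛ ((u′ , v′) ⊕ₛ (u″ , v″)))
        := proj₂ (((u , v) ⊗ₛ (u′ , v′)) ⊕ₛ ((u , v) ⊗ₛ (u″ , v″))))
      refl α β u v u′ v′ u″ v″

  ⊗-distribʳ : ∀ x y z → ((y ⊕ z) ⊗ x) ≋ ((y ⊗ x) ⊕ (z ⊗ x))
  ⊗-distribʳ (u , v) (u′ , v′) (u″ , v″) =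
    solve 8 (λ α β u v u′ v′ u″ v″ → let open SymbolicQuadratic R α β in
      proj₁ (((u′ , v′) ⊕ₛ (u″ , v″)) ⊗ₛ (u , v))
        := proj₁ (((u′ , v′) ⊗ₛ (u , v)) ⊕ₛ ((u″ , v″) ⊗ₛ (u , v))))
      refl α β u v u′ v′ u″ v″ ,
    solve 8 (λ α β u v u′ v′ u″ v″ → let open SymbolicQuadratic R α β in
      proj₂ (((u′ , v′) ⊕ₛ (u″ , v″)) ⊗ₛ (u , v))
        := proj₂ (((u′ , v′) ⊗ₛ (u , v)) ⊕ₛ ((u″ , v″) ⊗ₛ (u , v))))
      refl α β u v u′ v′ u″ v″

  ⊗-cong : ∀ {x x′ y y′} → x ≋ x′ → y ≋ y′ → (x ⊗ y) ≋ (x′ ⊗ y′)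
  ⊗-cong (e₁ , e₂) (f₁ , f₂) =
    +-cong (*-cong e₁ f₁) (-‿cong (*-congˡ (*-cong e₂ f₂))) ,
    +-cong (+-cong (*-cong e₁ f₂) (*-cong e₂ f₁)) (-‿cong (*-congˡ (*-cong e₂ f₂)))

  quadraticRing : CommutativeRing c ℓ
  quadraticRing = record
    { Carrier = Carrier × Carrier ; _≈_ = _≋_ ; _+_ = _⊕_ ; _*_ = _⊗_ ; -_ = ⊖_
    ; 0# = ι 0# ; 1# = ι 1#
    ; isCommutativeRing = record
      { isRing = record
        { +-isAbelianGroup = record
          { isGroup = record
            { isMonoid = record
              { isSemigroup = record
                { isMagma = record
                  { isEquivalence = record
                    { refl  = refl , refl
                    ; sym   = λ (e₁ , e₂) → sym e₁ , sym e₂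
                    ; trans = λ (e₁ , e₂) (f₁ , f₂) → trans e₁ f₁ , trans e₂ f₂ }
                  ; ∙-cong = λ (e₁ , e₂) (f₁ , f₂) → +-cong e₁ f₁ , +-cong e₂ f₂ }
                ; assoc = λ _ _ _ → +-assoc _ _ _ , +-assoc _ _ _ }
              ; identity = (λ _ → +-identityˡ _ , +-identityˡ _)
                         , (λ _ → +-identityʳ _ , +-identityʳ _) }
            ; inverse = (λ _ → -‿inverseˡ _ , -‿inverseˡ _) , (λ _ → -‿inverseʳ _ , -‿inverseʳ _)
            ; ⁻¹-cong = λ (e₁ , e₂) → -‿cong e₁ , -‿cong e₂ }
          ; comm = λ _ _ → +-comm _ _ , +-comm _ _ }
        ; *-cong     = ⊗-cong
        ; *-assoc    = ⊗-assoc
        ; *-identity = ⊗-identityˡ , ⊗-identityʳ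
        ; distrib    = ⊗-distribˡ , ⊗-distribʳ }
      ; *-comm = ⊗-comm } }

HasRoot : ∀ {c ℓ} (k : Field c ℓ) (α β : Field.Carrier k) → Set (c ⊔ ℓ)
HasRoot k α β = Σ Carrier λ r → r * r + α * r + β ≈ 0#
  where open Field k

-- If X² + αX + β has no root in the field k, then k[θ]/(θ² + αθ + β) is a
-- field: an element x ≠ 0 has nonzero norm, and conjugate x / norm x is its
-- inverse.
module QuadraticField {c ℓ} (k : Field c ℓ) (α β : Field.Carrier k)
  (irreducible : ¬ HasRoot k α β) where
  open Field k
  open IntegerSolver commutativeRing
  open QuadraticAlgebra commutativeRing α β
  open QuadraticRing commutativeRing α β

  -- a nonzero element has nonzero norm, because X² + αX + β has no root
  norm≉0 : ∀ x → ¬ (x ≋ ι 0#) → ¬ (norm x ≈ 0#)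
  norm≉0 (u , v) x≉0 N≈0 = ¬¬-excluded-middle λ
    { (yes v≈0) → let (u⁻¹ , uu⁻¹≈1) = inverse u (λ u≈0 → x≉0 (u≈0 , v≈0)) in
        x≉0 (u≈0 u⁻¹ v≈0 (as-difference uu⁻¹≈1) , v≈0)
    ; (no v≉0) → let (v⁻¹ , vv⁻¹≈1) = inverse v v≉0 in
        irreducible (- (u * v⁻¹) , root v⁻¹ (as-difference vv⁻¹≈1)) }
    where
      -- v = 0 forces norm x = u², so u = 0
      u≈0 : ∀ u⁻¹ → v ≈ 0# → u * u⁻¹ - 1# ≈ 0# → u ≈ 0#
      u≈0 u⁻¹ v≈0 h = drop-vanishing (solve 5 (λ α β u v u⁻¹ →
          let open SymbolicQuadratic commutativeRing α β in
          u := 0ₚ :+ (u⁻¹ :* normₛ (u , v)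
                     :+ u⁻¹ :* (α :* u :- β :* v) :* v :+ (:- u) :* (u :* u⁻¹ :- 1ₚ)))
        refl α β u v u⁻¹) (u⁻¹ ⊙₀ N≈0 ⊕₀ (u⁻¹ * (α * u - β * v)) ⊙₀ v≈0 ⊕₀ (- u) ⊙₀ h)
      -- v ≠ 0 makes −u/v a root, since norm x = v²·((−u/v)² + α(−u/v) + β)
      root : ∀ v⁻¹ → v * v⁻¹ - 1# ≈ 0# →
        (- (u * v⁻¹)) * (- (u * v⁻¹)) + α * (- (u * v⁻¹)) + β ≈ 0#
      root v⁻¹ h = drop-vanishing (solve 5 (λ α β u v v⁻¹ →
          let open SymbolicQuadratic commutativeRing α β in
          (:- (u :* v⁻¹)) :* (:- (u :* v⁻¹)) :+ α :* (:- (u :* v⁻¹)) :+ β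
            := 0ₚ :+ ((v⁻¹ :* v⁻¹) :* normₛ (u , v)
                     :+ (α :* u :* v⁻¹ :- β :* (v :* v⁻¹ :+ 1ₚ)) :* (v :* v⁻¹ :- 1ₚ)))
        refl α β u v v⁻¹) ((v⁻¹ * v⁻¹) ⊙₀ N≈0 ⊕₀ (α * u * v⁻¹ - β * (v * v⁻¹ + 1#)) ⊙₀ h)

  -- x · x̄ = norm x, so x̄ · (norm x)⁻¹ inverts x
  inverse-of : ∀ x n → norm x * n ≈ 1# → (x ⊗ (conjugate x ⊗ ι n)) ≋ ι 1#
  inverse-of (u , v) n Nn≈1 =
    drop-vanishing (solve 5 (λ α β u v n → let open SymbolicQuadratic commutativeRing α β in
        proj₁ ((u , v) ⊗ₛ (conjugateₛ (u , v) ⊗ₛ ιₛ n))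
          := 1ₚ :+ 1ₚ :* (normₛ (u , v) :* n :- 1ₚ))
      refl α β u v n) (1# ⊙₀ as-difference Nn≈1) ,
    solve 5 (λ α β u v n → let open SymbolicQuadratic commutativeRing α β in
        proj₂ ((u , v) ⊗ₛ (conjugateₛ (u , v) ⊗ₛ ιₛ n)) := 0ₚ)
      refl α β u v n

  L : Field c ℓ
  L = record
    { commutativeRing = quadraticRing
    ; 1≉0 = λ (1≈0 , _) → 1≉0 1≈0
    ; inverse = λ x x≉0 → let (n , Nn≈1) = inverse (norm x) (norm≉0 x x≉0) in
        _ , inverse-of x n Nn≈1 }

  ι-homomorphism : RingMorphisms.IsRingHomomorphism (rawRing) (Field.rawRing L) ι
  ι-homomorphism = record
    { isSemiringHomomorphism = record
      { isNearSemiringHomomorphism = record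
        { +-isMonoidHomomorphism = record
          { isMagmaHomomorphism = record
            { isRelHomomorphism = record { cong = λ x≈y → x≈y , refl }
            ; homo = λ _ _ → refl , sym (+-identityʳ 0#) }
          ; ε-homo = refl , refl }
        ; *-homo = λ x y →
            solve 4 (λ α β x y → let open SymbolicQuadratic commutativeRing α β in x :* y := proj₁ (ιₛ x ⊗ₛ ιₛ y)) refl α β x y ,
            solve 4 (λ α β x y → let open SymbolicQuadratic commutativeRing α β in 0ₚ := proj₂ (ιₛ x ⊗ₛ ιₛ y)) refl α β x y }
      ; 1#-homo = refl , refl }
    ; -‿homo = λ _ → refl , sym (-0#≈0#) }
    where
      open import Algebra.Properties.Ring ring using (-0#≈0#)

  θ-root : (((θ ⊗ θ) ⊕ (ι α ⊗ θ)) ⊕ ι β) ≋ ι 0#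
  θ-root =
    solve 2 (λ α β → let open SymbolicQuadratic commutativeRing α β in proj₁ (((θₛ ⊗ₛ θₛ) ⊕ₛ (ιₛ α ⊗ₛ θₛ)) ⊕ₛ ιₛ β) := 0ₚ) refl α β ,
    solve 2 (λ α β → let open SymbolicQuadratic commutativeRing α β in proj₂ (((θₛ ⊗ₛ θₛ) ⊕ₛ (ιₛ α ⊗ₛ θₛ)) ⊕ₛ ιₛ β) := 0ₚ) refl α β

-- Smoothness excludes both singular configurations: aK + b ≠ 0 by the
-- singular point (−a, −a), and K + a ≠ 0 by the singular points on the line
-- x + y + a = 0, which lie in k or in the quadratic extension of k
-- generated by a root of X² + aX + (a² − b).
module SmoothCurve {c ℓ} (k : Field c ℓ) (a b K : Field.Carrier k) (smooth : Smooth k a b K) where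
  open Field k

  private
    module OverBase = SingularPoints commutativeRing a b K 1≉0

    id-homomorphism : RingMorphisms.IsRingHomomorphism rawRing rawRing (λ z → z)
    id-homomorphism = isRingHomomorphism rawRing refl

    module OverExtension (irreducible : ¬ HasRoot k a (a * a - b)) where
      open QuadraticAlgebra commutativeRing a (a * a - b) using (ι; θ)
      open QuadraticField k a (a * a - b) irreducible
      private
        module L = Field L
        module ι-hom = RingMorphisms.IsRingHomomorphism ι-homomorphism
        module OverL = SingularPoints L.commutativeRing (ι a) (ι b) (ι K) L.1≉0

      θ-is-root : θ L.* θ L.+ ι a L.* θ L.+ (ι a L.* ι a L.- ι b) L.≈ L.0#
      θ-is-root = L.trans (L.+-congˡ (L.sym ι[a²-b]≈ιa²-ιb)) θ-root
        where
          ι[a²-b]≈ιa²-ιb : ι (a * a - b) L.≈ ι a L.* ι a L.- ι b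
          ι[a²-b]≈ιa²-ιb = L.trans (ι-hom.+-homo (a * a) (- b))
                                   (L.+-cong (ι-hom.*-homo a a) (ι-hom.-‿homo b))

      K+a≉0 : ¬ (K + a ≈ 0#)
      K+a≉0 K+a≈0 = smooth L ι ι-homomorphism _ (OverL.singular-on-line θ ιK+ιa≈0 θ-is-root)
        where
          ιK+ιa≈0 : ι K L.+ ι a L.≈ L.0#
          ιK+ιa≈0 = L.trans (L.sym (ι-hom.+-homo K a)) (ι-hom.⟦⟧-cong K+a≈0)

  aK+b≉0 : ¬ (a * K + b ≈ 0#)
  aK+b≉0 h = smooth k (λ z → z) id-homomorphism _ (OverBase.singular-diagonal h)

  K+a≉0 : ¬ (K + a ≈ 0#)
  K+a≉0 K+a≈0 = ¬¬-excluded-middle {A = HasRoot k a (a * a - b)} λ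
    { (yes (t , q≈0)) → smooth k (λ z → z) id-homomorphism _ (OverBase.singular-on-line t K+a≈0 q≈0)
    ; (no irreducible) → OverExtension.K+a≉0 irreducible K+a≈0 }

module Chords {c ℓ} (R : CommutativeRing c ℓ) (a b K : CommutativeRing.Carrier R)
  (1≉0 : ¬ (CommutativeRing._≈_ R (CommutativeRing.1# R) (CommutativeRing.0# R))) where
  open CommutativeRing R
  open IntegerSolver R
  open Curve R a b K
  open Triple

  -1≉0 : ¬ (- 1# ≈ 0#)
  -1≉0 -1≈0 = 1≉0 (drop-vanishing (solve 0 (1ₚ := 0ₚ :+ (:- 1ₚ) :* (:- 1ₚ)) refl) ((- 1#) ⊙₀ -1≈0))

  same-point : ∀ {P Q} → P ≈₃ Q → P ∼ Q
  same-point (eX , eY , eZ) = 1# , 1≉0 , trans eX (sym (*-identityˡ _))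
                                      , trans eY (sym (*-identityˡ _))
                                      , trans eZ (sym (*-identityˡ _))

  first-on-line : ∀ U V → U ∼ ((1# ·₃ U) +₃ (0# ·₃ V))
  first-on-line U V = same-point (e (X U) (X V) , e (Y U) (Y V) , e (Z U) (Z V))
    where
      e : ∀ u v → u ≈ 1# * u + 0# * v
      e = solve 2 (λ u v → u := 1ₚ :* u :+ 0ₚ :* v) refl

  second-on-line : ∀ U V → V ∼ ((0# ·₃ U) +₃ (1# ·₃ V))
  second-on-line U V = same-point (e (X U) (X V) , e (Y U) (Y V) , e (Z U) (Z V))
    where
      e : ∀ u v → v ≈ 0# * u + 1# * v
      e = solve 2 (λ u v → v := 0ₚ :* u :+ 1ₚ :* v) refl

  line-through : ∀ U V s t κ {W} → ¬ IsZero₃ (cross U V) → ¬ (κ ≈ 0#) →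
    W ≈₃ ((s ·₃ U) +₃ (t ·₃ V)) →
    FonLine U V ≈C (κ ·C mul3 (rootForm 1# 0#) (rootForm 0# 1#) (rootForm s t)) →
    LineMeets U V W
  line-through U V s t κ U≠V κ≉0 W≈sU+tV restriction =
    U , V , 1# , 0# , 0# , 1# , s , t , κ , U≠V ,
    first-on-line U V , second-on-line U V , same-point W≈sU+tV , κ≉0 , restriction

  meets-y=-a : ∀ u v → OnC ⟨ u , v , 1# ⟩ → v + a ≈ 0# → u * (a * K + b) ≈ 0#
  meets-y=-a u v F≈0 v+a≈0 = drop-vanishing (solve 5 (λ a b K u v → let module S = Symbolic R a b K in
      u :* (a :* K :+ b)
        := 0ₚ :+ (1ₚ :* S.F ⟨ u , v , 1ₚ ⟩
                  :+ (:- (u :* v :+ u :* u :- K :* u :+ b :+ a :* v :+ a :* u)) :* (v :+ a)))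
    refl a b K u v) (1# ⊙₀ F≈0 ⊕₀ (- (u * v + u * u - K * u + b + a * v + a * u)) ⊙₀ v+a≈0)

  meets-x+y=K : ∀ u v → OnC ⟨ u , v , 1# ⟩ → u + v - K ≈ 0# → (K + a) * (a * K + b) ≈ 0#
  meets-x+y=K u v F≈0 σ≈K = drop-vanishing (solve 5 (λ a b K u v → let module S = Symbolic R a b K in
      (K :+ a) :* (a :* K :+ b)
        := 0ₚ :+ (1ₚ :* S.F ⟨ u , v , 1ₚ ⟩
                  :+ (:- (u :* v :+ a :* (u :+ v) :+ a :* a :+ a :* K :+ b)) :* (u :+ v :- K)))
    refl a b K u v) (1# ⊙₀ F≈0 ⊕₀ (- (u * v + a * (u + v) + a * a + a * K + b)) ⊙₀ σ≈K)

  -- F(X, v, 1) = (v + a)X² + B·X + (v + a)(av + b) with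
  -- B = v² + 2av + a² + b − Kv, so the two affine points of C on the line
  -- y = v have product of abscissae av + b (Vieta).
  horizontal-partner : ∀ u v w → OnC ⟨ u , v , 1# ⟩ → u * w ≈ 1# → OnC ⟨ (a * v + b) * w , v , 1# ⟩
  horizontal-partner u v w F≈0 uw≈1 = drop-vanishing (solve 6 (λ a b K u v w →
      let module S = Symbolic R a b K
          m = a :* v :+ b
          B = v :* v :+ a :* v :+ a :* v :+ a :* a :+ b :- K :* v
      in S.F ⟨ m :* w , v , 1ₚ ⟩
           := 0ₚ :+ ((m :* w :* w) :* S.F ⟨ u , v , 1ₚ ⟩
                     :+ (:- ((v :+ a) :* m :* (1ₚ :+ u :* w) :+ B :* m :* w)) :* (u :* w :- 1ₚ)))
    refl a b K u v w)
    ((m * w * w) ⊙₀ F≈0 ⊕₀ (- ((v + a) * m * (1# + u * w) + B * m * w)) ⊙₀ as-difference uw≈1)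
    where
      m B : Carrier
      m = a * v + b
      B = v * v + a * v + a * v + a * a + b - K * v

  private
    horizontal-line horizontal-product : ∀ {n} (a b K u v w : Polynomial n) → Cub (Polynomial n)
    horizontal-line a b K u v w = S.FonLine ⟨ u , v , 1ₚ ⟩ S.𝒫
      where module S = Symbolic R a b K
    horizontal-product a b K u v w =
      (v :+ a) S.·C S.mul3 (S.rootForm 1ₚ 0ₚ) (S.rootForm 0ₚ 1ₚ) (S.rootForm 1ₚ ((a :* v :+ b) :* w :- u))
      where module S = Symbolic R a b K

    mirror-line mirror-product : ∀ {n} (a b K u v : Polynomial n) → Cub (Polynomial n)
    mirror-line a b K u v = S.FonLine S.𝒪 ⟨ u , v , 1ₚ ⟩
      where module S = Symbolic R a b K
    mirror-product a b K u v =
      (u :+ v :- K) S.·C S.mul3 (S.rootForm 1ₚ 0ₚ) (S.rootForm 0ₚ 1ₚ) (S.rootForm (v :- u) 1ₚ)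
      where module S = Symbolic R a b K

  -- On the line through (u, v) and 𝒫, parametrised as s·(u, v, 1) + t·𝒫, F is
  -- (v + a)·s·t·(t − (x′ − u)s) where x′ = (av + b)/u: the s³-coefficient is
  -- F(u, v, 1), and the s²t-coefficient vanishes by Vieta.
  horizontal-restriction : ∀ u v w → OnC ⟨ u , v , 1# ⟩ → u * w ≈ 1# →
    FonLine ⟨ u , v , 1# ⟩ 𝒫
      ≈C ((v + a) ·C mul3 (rootForm 1# 0#) (rootForm 0# 1#) (rootForm 1# ((a * v + b) * w - u)))
  horizontal-restriction u v w F≈0 uw≈1 =
    drop-vanishing (solve 6 (λ a b K u v w →
        Cub.c30 (horizontal-line a b K u v w)
          := Cub.c30 (horizontal-product a b K u v w) :+ 1ₚ :* Symbolic.F R a b K ⟨ u , v , 1ₚ ⟩)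
      refl a b K u v w) (1# ⊙₀ F≈0) ,
    drop-vanishing (solve 6 (λ a b K u v w →
        Cub.c21 (horizontal-line a b K u v w)
          := Cub.c21 (horizontal-product a b K u v w)
             :+ (w :* Symbolic.F R a b K ⟨ u , v , 1ₚ ⟩
                 :+ (:- ((v :+ a) :* u :+ (v :* v :+ a :* v :+ a :* v :+ a :* a :+ b :- K :* v)))
                    :* (u :* w :- 1ₚ)))
      refl a b K u v w) (w ⊙₀ F≈0 ⊕₀ (- ((v + a) * u + B)) ⊙₀ as-difference uw≈1) ,
    solve 6 (λ a b K u v w →
        Cub.c12 (horizontal-line a b K u v w) := Cub.c12 (horizontal-product a b K u v w))
      refl a b K u v w ,
    solve 6 (λ a b K u v w →
        Cub.c03 (horizontal-line a b K u v w) := Cub.c03 (horizontal-product a b K u v w))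
      refl a b K u v w
    where
      B : Carrier
      B = v * v + a * v + a * v + a * a + b - K * v

  -- The horizontal line through (u, v) and 𝒫 meets C again at
  -- ((av + b)/u, v), provided v ≠ −a (otherwise 𝒫 is a double point of
  -- the intersection).
  horizontal-chord : ∀ u v w → OnC ⟨ u , v , 1# ⟩ → u * w ≈ 1# → ¬ (v + a ≈ 0#) →
    LineMeets ⟨ u , v , 1# ⟩ 𝒫 ⟨ (a * v + b) * w , v , 1# ⟩
  horizontal-chord u v w F≈0 uw≈1 v+a≉0 =
    line-through ⟨ u , v , 1# ⟩ 𝒫 1# (u′ - u) (v + a)
      (λ (_ , 1-u0≈0 , _) → 1≉0 (trans (solve 1 (λ u → 1ₚ := 1ₚ :* 1ₚ :- u :* 0ₚ) refl u) 1-u0≈0))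
      v+a≉0
      ( solve 2 (λ u u′ → u′ := 1ₚ :* u :+ (u′ :- u) :* 1ₚ) refl u u′
      , solve 3 (λ u v u′ → v := 1ₚ :* v :+ (u′ :- u) :* 0ₚ) refl u v u′
      , solve 2 (λ u u′ → 1ₚ := 1ₚ :* 1ₚ :+ (u′ :- u) :* 0ₚ) refl u u′ )
      (horizontal-restriction u v w F≈0 uw≈1)
    where
      u′ : Carrier
      u′ = (a * v + b) * w

  mirror-restriction : ∀ u v → OnC ⟨ u , v , 1# ⟩ →
    FonLine 𝒪 ⟨ u , v , 1# ⟩
      ≈C ((u + v - K) ·C mul3 (rootForm 1# 0#) (rootForm 0# 1#) (rootForm (v - u) 1#))
  mirror-restriction u v F≈0 =
    solve 5 (λ a b K u v → Cub.c30 (mirror-line a b K u v) := Cub.c30 (mirror-product a b K u v))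
      refl a b K u v ,
    solve 5 (λ a b K u v → Cub.c21 (mirror-line a b K u v) := Cub.c21 (mirror-product a b K u v))
      refl a b K u v ,
    solve 5 (λ a b K u v → Cub.c12 (mirror-line a b K u v) := Cub.c12 (mirror-product a b K u v))
      refl a b K u v ,
    drop-vanishing (solve 5 (λ a b K u v →
        Cub.c03 (mirror-line a b K u v)
          := Cub.c03 (mirror-product a b K u v) :+ 1ₚ :* Symbolic.F R a b K ⟨ u , v , 1ₚ ⟩)
      refl a b K u v) (1# ⊙₀ F≈0)

  -- The line through 𝒪 and (u, v) is x + y = u + v, and it meets C again at
  -- the mirror image (v, u), provided u + v ≠ K (otherwise 𝒪 is a double
  -- point of the intersection).
  chord-through-𝒪 : ∀ u v → OnC ⟨ u , v , 1# ⟩ → ¬ (u + v - K ≈ 0#) →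
    LineMeets 𝒪 ⟨ u , v , 1# ⟩ ⟨ v , u , 1# ⟩
  chord-through-𝒪 u v F≈0 κ≉0 =
    line-through 𝒪 ⟨ u , v , 1# ⟩ (v - u) 1# (u + v - K)
      (λ (-1-0v≈0 , _ , _) → -1≉0 (trans (solve 1 (λ v → :- 1ₚ := (:- 1ₚ) :* 1ₚ :- 0ₚ :* v) refl v) -1-0v≈0))
      κ≉0
      ( solve 2 (λ u v → v := (v :- u) :* 1ₚ :+ 1ₚ :* u) refl u v
      , solve 2 (λ u v → u := (v :- u) :* (:- 1ₚ) :+ 1ₚ :* v) refl u v
      , solve 2 (λ u v → 1ₚ := (v :- u) :* 0ₚ :+ 1ₚ :* 1ₚ) refl u v )
      (mirror-restriction u v F≈0)

product≉0 : ∀ {c ℓ} (k : Field c ℓ) {u v : Field.Carrier k} →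
  ¬ (Field._≈_ k u (Field.0# k)) → ¬ (Field._≈_ k v (Field.0# k)) →
  ¬ (Field._≈_ k (Field._*_ k u v) (Field.0# k))
product≉0 k {u} {v} u≉0 v≉0 uv≈0 = v≉0 (cancel (inverse u u≉0))
  where
    open Field k
    open IntegerSolver commutativeRing

    cancel : (Σ Carrier λ u⁻¹ → u * u⁻¹ ≈ 1#) → v ≈ 0#
    cancel (u⁻¹ , uu⁻¹≈1) = drop-vanishing
      (solve 3 (λ u v u⁻¹ → v := 0ₚ :+ (u⁻¹ :* (u :* v) :+ (:- v) :* (u :* u⁻¹ :- 1ₚ))) refl u v u⁻¹)
      (u⁻¹ ⊙₀ uv≈0 ⊕₀ (- v) ⊙₀ as-difference uu⁻¹≈1)

mainTheorem1 : ∀ {c ℓ} (k : Field c ℓ) (a b K : Field.Carrier k) →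
    ¬ (Field._≈_ k a (Field.0# k)) →
    Smooth k a b K →
    (x y : Field.Carrier k) →
    Curve.OnC (Field.commutativeRing k) a b K ⟨ x , y , Field.1# k ⟩ →
    ¬ (Field._≈_ k x (Field.0# k)) →
    (w : Field.Carrier k) → Field._≈_ k (Field._*_ k x w) (Field.1# k) →
    Curve.IsSum (Field.commutativeRing k) a b K
      ⟨ x , y , Field.1# k ⟩
      (Curve.𝒫 (Field.commutativeRing k) a b K)
      ⟨ y , Field._*_ k (Field._+_ k (Field._*_ k a y) b) w , Field.1# k ⟩
mainTheorem1 k a b K _ smooth x y Q∈C x≉0 w xw≈1 =
  ⟨ x′ , y , 1# ⟩ , horizontal-chord x y w Q∈C xw≈1 y+a≉0 , chord-through-𝒪 x′ y R∈C x′+y≉K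
  where
    open Field k
    open SmoothCurve k a b K smooth
    open Chords commutativeRing a b K 1≉0

    x′ : Carrier
    x′ = (a * y + b) * w

    y+a≉0 : ¬ (y + a ≈ 0#)
    y+a≉0 y+a≈0 = product≉0 k x≉0 aK+b≉0 (meets-y=-a x y Q∈C y+a≈0)

    R∈C : Curve.OnC commutativeRing a b K ⟨ x′ , y , 1# ⟩
    R∈C = horizontal-partner x y w Q∈C xw≈1

    x′+y≉K : ¬ (x′ + y - K ≈ 0#)
    x′+y≉K x′+y≈K = product≉0 k K+a≉0 aK+b≉0 (meets-x+y=K x′ y R∈C x′+y≈K)
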